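{- Let $l_1 \le m_1$ be positive integers and $k$ a positive integer. Let \[ h^{(1)}(l_1,m_1) = \#\{X \subseteq [l_1,m_1] :\ l_1 \in X \text{ and } \gcd(X) = 1\}, \] \[ h^{(1)}_k(l_1,m_1) = \#\{X \subseteq [l_1,m_1] :\ l_1 \in X,\ \#X = k, \text{ and } \gcd(X) = 1\}. \] Then (a) $\displaystyle h^{(1)}(l_1,m_1) = \sum_{d \mid l_1} \mu(d)\, 2^{\lfloor m_1/d\rfloor - l_1/d}$; (b) $\displaystyle h^{(1)}_k(l_1,m_1) = \sum_{d \mid l_1} \mu(d) \binom{\lfloor m_1/d\rfloor - l_1/d}{k-1}$.
   Context: For positive integers $l \le m$, $[l,m] = \{l, l+1, \ldots, m\}$. $\mu$ is the Möbius function, $\lfloor x\rfloor$ is the floor of $x$, and $\gcd(X)$ is the greatest common divisor of the elements of a nonempty finite set $X$ of positive integers. The sums are over positive divisors $d$ of $l_1$. -}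

module Defs where

open import Data.Nat using (ℕ; zero; suc; _+_; _*_; _∸_; _≤_; _≟_)
import Data.Nat
open import Data.Nat.Divisibility using (_∣_; _∣?_)
open import Data.Nat.Primality using (Prime; prime?)
open import Data.Nat.GCD using (gcd)
open import Data.Integer as Z using (ℤ; -_)
open Z using () renaming (+_ to ℤ+)
open import Data.List using (List; []; _∷_; map; _++_; applyUpTo; filter; length; foldr; any)
open import Data.List.Relation.Unary.Any using (Any; any?)
open import Data.List.Membership.Propositional using (_∈_)
open import Data.List.Membership.DecPropositional _≟_ using (_∈?_)
open import Relation.Nullary using (Dec; yes; no; ¬?)
open import Relation.Nullary.Decidable using (_×-dec_)
open import Relation.Binary.PropositionalEquality using (_≡_)
open import Data.Product using (_×_)

interval : ℕ → ℕ → List ℕ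
interval l m = applyUpTo (λ i → l + i) (suc m ∸ l)

-- All sub-lists of a list (the power set of the underlying finite set,
-- for a list without duplicates), each subset listed exactly once.
powerset : List ℕ → List (List ℕ)
powerset []       = [] ∷ []
powerset (x ∷ xs) = powerset xs ++ map (x ∷_) (powerset xs)

-- gcd of a finite set (list) of naturals; gcd(∅) = 0 is never used below
-- since the sets considered contain l₁.
gcdList : List ℕ → ℕ
gcdList = foldr gcd 0

divisors : ℕ → List ℕ
divisors n = filter (_∣? n) (interval 1 n)

primeDivisors : ℕ → List ℕ
primeDivisors d = filter (λ p → prime? p ×-dec (p ∣? d)) (interval 1 d)

hasSquareFactor : ℕ → Set
hasSquareFactor d = Any (λ p → p * p ∣ d) (primeDivisors d)

hasSquareFactor? : (d : ℕ) → Dec (hasSquareFactor d)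
hasSquareFactor? d = any? (λ p → (p * p) ∣? d) (primeDivisors d)

signPow : ℕ → ℤ
signPow zero    = ℤ+ 1
signPow (suc r) = - signPow r

μ : ℕ → ℤ
μ d with hasSquareFactor? d
... | yes _ = ℤ+ 0
... | no  _ = signPow (length (primeDivisors d))

sumℤ : List ℤ → ℤ
sumℤ = foldr Z._+_ (ℤ+ 0)

h1 : ℕ → ℕ → ℕ
h1 l m = length (filter (λ X → (l ∈? X) ×-dec (gcdList X ≟ 1)) (powerset (interval l m)))

h1k : ℕ → ℕ → ℕ → ℕ
h1k k l m = length (filter (λ X → (l ∈? X) ×-dec ((length X ≟ k) ×-dec (gcdList X ≟ 1))) (powerset (interval l m)))

-- Floor division m / d, made total (value 0 at d = 0); only ever applied
-- to positive divisors d of l₁, where it agrees with Data.Nat._/_.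
_div_ : ℕ → ℕ → ℕ
m div zero    = 0
m div (suc e) = m Data.Nat./ suc e

{-# OPTIONS --safe #-}

-- For a set X containing l₁, gcd(X) divides l₁, so the Möbius identity
-- Σ_{d ∣ n} μ(d) = [n = 1] (applied to n = gcd X) rewrites [gcd X = 1] as
-- Σ_{d ∣ l₁} μ(d) [d divides every element of X].  Exchanging the sums, for each
-- d ∣ l₁ one counts the subsets of (l₁, m₁] made of multiples of d; there are
-- ⌊m₁/d⌋ − l₁/d such multiples, hence 2^that subsets, C(that, k − 1) of them of
-- size k − 1.  The Möbius identity for n > 1 comes from a prime p ∣ n: a divisor
-- i of n/p with p ∤ i pairs with the divisor i p, and μ(i p) = −μ(i), while
-- μ(i p) = 0 when p ∣ i.

module Submission where

open import Data.Empty using (⊥-elim)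
open import Data.Integer using (ℤ; +_; -_; _+_; _*_)
import Data.Integer.Properties as ℤₚ
open import Data.Integer.Tactic.RingSolver using (solve-∀)
open import Data.List using (List; []; _∷_; map; _++_; applyUpTo; filter; length; [_])
import Data.List.Properties as Listₚ
open import Data.List.Membership.Propositional using (_∈_; _∉_; lose; find)
open import Data.List.Membership.Propositional.Properties
  using (∈-filter⁺; ∈-filter⁻; ∈-applyUpTo⁺; ∈-applyUpTo⁻)
open import Data.List.Relation.Unary.All as All using (All; []; _∷_; all?)
import Data.List.Relation.Unary.All.Properties as All
open import Data.List.Relation.Unary.Any using (here; there)
open import Data.Nat as ℕ
  using (ℕ; zero; suc; 2+; _≤_; _<_; _∸_; _^_; z≤n; s≤s; NonZero; NonTrivial)
import Data.Nat.Properties as ℕₚ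
open import Data.Nat.Combinatorics using (_C_; nCk+nC[k+1]≡[n+1]C[k+1])
open import Data.Nat.Coprimality using (Coprime; coprime-divisor)
open import Data.Nat.Divisibility
  using ( _∣_; _∣?_; divides; ∣-trans; ∣⇒≤; n∣m*n; m∣m*n; ∣m⇒∣m*n; ∣m+n∣m⇒∣n
        ; *-monoˡ-∣; *-cancelʳ-∣; 0∣⇒≡0; _∣0)
open import Data.Nat.DivMod using (_/_; _%_; m≡m%n+[m/n]*n; m%n<n)
open import Data.Nat.GCD using (gcd[m,n]∣m; gcd[m,n]∣n; gcd-greatest)
open import Data.Nat.ListAction using (product)
open import Data.Nat.Primality
  using (Prime; prime?; prime⇒nonZero; prime⇒nonTrivial; prime⇒irreducible; euclidsLemma)
open import Data.Nat.Primality.Factorisation using (factorise)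
open import Data.Product using (_×_; _,_; ∃; proj₁; proj₂)
open import Data.Sum using (inj₁; inj₂; reduce)
open import Function using (_∘_; case_of_)
open import Relation.Binary.PropositionalEquality
  using (_≡_; _≢_; refl; sym; trans; cong; cong₂; subst; module ≡-Reasoning)
open import Relation.Nullary using (Dec; yes; no; ¬_)
open import Relation.Nullary.Decidable using (_×-dec_; ¬?)
open import Data.List.Membership.DecPropositional ℕ._≟_ using (_∈?_)

open import Defs

private variable
  A B : Set

-- Indicators and finite sums

𝟙 : Dec A → ℤ
𝟙 (yes _) = + 1
𝟙 (no _)  = + 0

𝟙-yes : (a? : Dec A) → A → 𝟙 a? ≡ + 1
𝟙-yes (yes _) _ = refl
𝟙-yes (no ¬a) a = ⊥-elim (¬a a)

𝟙-no : (a? : Dec A) → ¬ A → 𝟙 a? ≡ + 0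
𝟙-no (yes a) ¬a = ⊥-elim (¬a a)
𝟙-no (no _)  _  = refl

𝟙-cong : (a? : Dec A) (b? : Dec B) → (A → B) → (B → A) → 𝟙 a? ≡ 𝟙 b?
𝟙-cong (yes _) (yes _) _ _ = refl
𝟙-cong (yes a) (no ¬b) f _ = ⊥-elim (¬b (f a))
𝟙-cong (no ¬a) (yes b) _ g = ⊥-elim (¬a (g b))
𝟙-cong (no _)  (no _)  _ _ = refl

𝟙-×-dec : (a? : Dec A) (b? : Dec B) → 𝟙 (a? ×-dec b?) ≡ 𝟙 a? * 𝟙 b?
𝟙-×-dec (yes _) (yes _) = refl
𝟙-×-dec (yes _) (no _)  = refl
𝟙-×-dec (no _)  (yes _) = refl
𝟙-×-dec (no _)  (no _)  = refl

𝟙-split : (a? : Dec A) (x : ℤ) → x ≡ 𝟙 a? * x + 𝟙 (¬? a?) * x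
𝟙-split (yes _) = solve-∀
𝟙-split (no _)  = solve-∀

𝟙-*-cong : ∀ (a? : Dec A) {x y} → (A → x ≡ y) → 𝟙 a? * x ≡ 𝟙 a? * y
𝟙-*-cong (yes a) eq = cong (+ 1 *_) (eq a)
𝟙-*-cong (no _)  _  = refl

𝟙-suc-≟ : ∀ m n → 𝟙 (suc m ℕ.≟ suc n) ≡ 𝟙 (m ℕ.≟ n)
𝟙-suc-≟ m n = 𝟙-cong (suc m ℕ.≟ suc n) (m ℕ.≟ n) ℕₚ.suc-injective (cong suc)

sumTo : (ℕ → ℤ) → ℕ → ℤ
sumTo f zero    = + 0
sumTo f (suc n) = sumTo f n + f (suc n)

module _ {f g : ℕ → ℤ} where

  sumTo-cong : ∀ n → (∀ i → 1 ≤ i → i ≤ n → f i ≡ g i) → sumTo f n ≡ sumTo g n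
  sumTo-cong zero    _  = refl
  sumTo-cong (suc n) eq =
    cong₂ _+_ (sumTo-cong n λ i 1≤i i≤n → eq i 1≤i (ℕₚ.m≤n⇒m≤1+n i≤n)) (eq (suc n) (s≤s z≤n) ℕₚ.≤-refl)

  sumTo-+ : ∀ n → sumTo (λ i → f i + g i) n ≡ sumTo f n + sumTo g n
  sumTo-+ zero    = refl
  sumTo-+ (suc n) rewrite sumTo-+ n = +-interchange (sumTo f n) (sumTo g n) (f (suc n)) (g (suc n))
    where
    +-interchange : ∀ a b c d → a + b + (c + d) ≡ a + c + (b + d)
    +-interchange = solve-∀

sumTo-zero : ∀ {f} n → (∀ i → 1 ≤ i → i ≤ n → f i ≡ + 0) → sumTo f n ≡ + 0
sumTo-zero zero    _  = refl
sumTo-zero (suc n) eq =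
  cong₂ _+_ (sumTo-zero n λ i 1≤i i≤n → eq i 1≤i (ℕₚ.m≤n⇒m≤1+n i≤n)) (eq (suc n) (s≤s z≤n) ℕₚ.≤-refl)

sumTo-neg : ∀ f n → sumTo (λ i → - f i) n ≡ - sumTo f n
sumTo-neg f zero    = refl
sumTo-neg f (suc n) rewrite sumTo-neg f n = sym (ℤₚ.neg-distrib-+ (sumTo f n) (f (suc n)))

sumTo-+-split : ∀ f a b → sumTo f (a ℕ.+ b) ≡ sumTo f a + sumTo (λ i → f (a ℕ.+ i)) b
sumTo-+-split f a zero    rewrite ℕₚ.+-identityʳ a = sym (ℤₚ.+-identityʳ _)
sumTo-+-split f a (suc b) rewrite ℕₚ.+-suc a b | sumTo-+-split f a b = ℤₚ.+-assoc (sumTo f a) _ _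

sumTo-truncate : ∀ f {a n} → a ≤ n → (∀ i → a < i → i ≤ n → f i ≡ + 0) → sumTo f n ≡ sumTo f a
sumTo-truncate f {a} {n} a≤n vanish = begin
  sumTo f n                                         ≡⟨ cong (sumTo f) (sym a+b≡n) ⟩
  sumTo f (a ℕ.+ b)                                 ≡⟨ sumTo-+-split f a b ⟩
  sumTo f a + sumTo (λ i → f (a ℕ.+ i)) b           ≡⟨ cong (λ z → sumTo f a + z) (sumTo-zero b tail) ⟩
  sumTo f a + + 0                                   ≡⟨ ℤₚ.+-identityʳ _ ⟩
  sumTo f a                                         ∎
  where
  open ≡-Reasoning
  b : ℕ
  b = n ∸ a
  a+b≡n : a ℕ.+ b ≡ n
  a+b≡n = ℕₚ.m+[n∸m]≡n a≤n
  tail : ∀ i → 1 ≤ i → i ≤ b → f (a ℕ.+ i) ≡ + 0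
  tail i 1≤i i≤b = vanish (a ℕ.+ i) (ℕₚ.m<m+n a 1≤i) (subst (a ℕ.+ i ≤_) a+b≡n (ℕₚ.+-monoʳ-≤ a i≤b))

sumTo-partition : ∀ {P : ℕ → Set} (P? : ∀ i → Dec (P i)) f n →
  sumTo f n ≡ sumTo (λ i → 𝟙 (P? i) * f i) n + sumTo (λ i → 𝟙 (¬? (P? i)) * f i) n
sumTo-partition P? f n = trans (sumTo-cong n λ i _ _ → 𝟙-split (P? i) (f i)) (sumTo-+ n)

sumTo-multiples : ∀ p .{{_ : NonZero p}} (F : ℕ → ℤ) N →
  sumTo (λ e → 𝟙 (p ∣? e) * F e) (N ℕ.* p) ≡ sumTo (λ i → F (i ℕ.* p)) N
sumTo-multiples p       F zero    = refl
sumTo-multiples (suc p) F (suc N) = begin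
  sumTo g (suc p ℕ.+ N ℕ.* P)                            ≡⟨ cong (sumTo g) (ℕₚ.+-comm (suc p) (N ℕ.* P)) ⟩
  sumTo g (N ℕ.* P ℕ.+ suc p)                            ≡⟨ sumTo-+-split g (N ℕ.* P) (suc p) ⟩
  sumTo g (N ℕ.* P) + (sumTo (λ i → g (N ℕ.* P ℕ.+ i)) p + g (N ℕ.* P ℕ.+ P))
    ≡⟨ cong₂ _+_ (sumTo-multiples P F N) (cong₂ _+_ between last) ⟩
  sumTo (λ i → F (i ℕ.* P)) N + (+ 0 + F (suc N ℕ.* P))
    ≡⟨ cong (λ z → sumTo (λ i → F (i ℕ.* P)) N + z) (ℤₚ.+-identityˡ _) ⟩
  sumTo (λ i → F (i ℕ.* P)) N + F (suc N ℕ.* P)          ∎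
  where
  open ≡-Reasoning
  P : ℕ
  P = suc p
  g : ℕ → ℤ
  g e = 𝟙 (P ∣? e) * F e
  between : sumTo (λ i → g (N ℕ.* P ℕ.+ i)) p ≡ + 0
  between = sumTo-zero p λ i 1≤i i≤p → cong (_* F (N ℕ.* P ℕ.+ i)) (𝟙-no (P ∣? (N ℕ.* P ℕ.+ i))
    λ P∣ → ℕₚ.<⇒≱ (s≤s i≤p) (∣⇒≤ {{ℕ.>-nonZero 1≤i}} (∣m+n∣m⇒∣n P∣ (n∣m*n N))))
  last : g (N ℕ.* P ℕ.+ P) ≡ F (suc N ℕ.* P)
  last rewrite ℕₚ.+-comm (N ℕ.* P) P
             | 𝟙-yes (P ∣? (suc N ℕ.* P)) (n∣m*n (suc N)) = ℤₚ.*-identityˡ _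

sumℤ-++ : ∀ xs ys → sumℤ (xs ++ ys) ≡ sumℤ xs + sumℤ ys
sumℤ-++ []       ys = sym (ℤₚ.+-identityˡ _)
sumℤ-++ (x ∷ xs) ys rewrite sumℤ-++ xs ys = sym (ℤₚ.+-assoc x _ _)

sumℤ-cong : ∀ {f g : A → ℤ} xs → (∀ {x} → x ∈ xs → f x ≡ g x) → sumℤ (map f xs) ≡ sumℤ (map g xs)
sumℤ-cong []       _  = refl
sumℤ-cong (x ∷ xs) eq = cong₂ _+_ (eq (here refl)) (sumℤ-cong xs (eq ∘ there))

sumℤ-zero : ∀ {f : A → ℤ} xs → (∀ {x} → x ∈ xs → f x ≡ + 0) → sumℤ (map f xs) ≡ + 0
sumℤ-zero []       _  = refl
sumℤ-zero (x ∷ xs) eq rewrite eq (here refl) | sumℤ-zero xs (eq ∘ there) = refl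

sumℤ-*ˡ : ∀ c (f : A → ℤ) xs → sumℤ (map (λ x → c * f x) xs) ≡ c * sumℤ (map f xs)
sumℤ-*ˡ c f []       = sym (ℤₚ.*-zeroʳ c)
sumℤ-*ˡ c f (x ∷ xs) rewrite sumℤ-*ˡ c f xs = sym (ℤₚ.*-distribˡ-+ c (f x) _)

sumℤ-+ : ∀ (f g : A → ℤ) xs → sumℤ (map (λ x → f x + g x) xs) ≡ sumℤ (map f xs) + sumℤ (map g xs)
sumℤ-+ f g []       = refl
sumℤ-+ f g (x ∷ xs) rewrite sumℤ-+ f g xs = +-interchange (f x) (g x) (sumℤ (map f xs)) (sumℤ (map g xs))
  where
  +-interchange : ∀ a b c d → a + b + (c + d) ≡ a + c + (b + d)
  +-interchange = solve-∀

sumℤ-swap : ∀ (f : A → B → ℤ) xs ys →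
  sumℤ (map (λ x → sumℤ (map (f x) ys)) xs) ≡ sumℤ (map (λ y → sumℤ (map (λ x → f x y) xs)) ys)
sumℤ-swap f []       ys = sym (sumℤ-zero ys λ _ → refl)
sumℤ-swap f (x ∷ xs) ys rewrite sumℤ-swap f xs ys = sym (sumℤ-+ (f x) _ ys)

module _ {P : A → Set} (P? : ∀ x → Dec (P x)) where

  length-filter : ∀ xs → + length (filter P? xs) ≡ sumℤ (map (𝟙 ∘ P?) xs)
  length-filter []       = refl
  length-filter (x ∷ xs) with P? x
  ... | yes _ = cong (_+_ (+ 1)) (length-filter xs)
  ... | no _  = trans (length-filter xs) (sym (ℤₚ.+-identityˡ _))

  sumℤ-filter : ∀ (f : A → ℤ) xs → sumℤ (map f (filter P? xs)) ≡ sumℤ (map (λ x → 𝟙 (P? x) * f x) xs)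
  sumℤ-filter f []       = refl
  sumℤ-filter f (x ∷ xs) with P? x
  ... | yes _ = cong₂ _+_ (sym (ℤₚ.*-identityˡ (f x))) (sumℤ-filter f xs)
  ... | no _  = trans (sumℤ-filter f xs) (sym (ℤₚ.+-identityˡ _))

sumℤ-interval : ∀ f n → sumℤ (map f (interval 1 n)) ≡ sumTo f n
sumℤ-interval f zero    = refl
sumℤ-interval f (suc n) = begin
  sumℤ (map f (applyUpTo suc (suc n)))            ≡⟨ cong (sumℤ ∘ map f) (sym (Listₚ.applyUpTo-∷ʳ suc n)) ⟩
  sumℤ (map f (applyUpTo suc n ++ [ suc n ]))     ≡⟨ cong sumℤ (Listₚ.map-++ f (applyUpTo suc n) [ suc n ]) ⟩
  sumℤ (map f (applyUpTo suc n) ++ [ f (suc n) ]) ≡⟨ sumℤ-++ (map f (applyUpTo suc n)) _ ⟩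
  sumℤ (map f (applyUpTo suc n)) + (f (suc n) + + 0) ≡⟨ cong₂ _+_ (sumℤ-interval f n) (ℤₚ.+-identityʳ _) ⟩
  sumTo f n + f (suc n)                           ∎
  where open ≡-Reasoning

sumℤ-divisors : ∀ f n → sumℤ (map f (divisors n)) ≡ sumTo (λ d → 𝟙 (d ∣? n) * f d) n
sumℤ-divisors f n = trans (sumℤ-filter (_∣? n) f (interval 1 n)) (sumℤ-interval _ n)

applyUpTo-cong : ∀ {f g : ℕ → A} n → (∀ i → f i ≡ g i) → applyUpTo f n ≡ applyUpTo g n
applyUpTo-cong zero    _  = refl
applyUpTo-cong (suc n) eq = cong₂ _∷_ (eq 0) (applyUpTo-cong n (eq ∘ suc))

applyUpTo-+ : ∀ (f : ℕ → A) a b → applyUpTo f (a ℕ.+ b) ≡ applyUpTo f a ++ applyUpTo (λ i → f (a ℕ.+ i)) b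
applyUpTo-+ f zero    b = refl
applyUpTo-+ f (suc a) b = cong (f 0 ∷_) (applyUpTo-+ (f ∘ suc) a b)

interval-∷ : ∀ {l m} → l ≤ m → interval l m ≡ l ∷ interval (suc l) m
interval-∷ {l} {m} l≤m rewrite ℕₚ.+-∸-assoc 1 l≤m =
  cong₂ _∷_ (ℕₚ.+-identityʳ l) (applyUpTo-cong (m ∸ l) (ℕₚ.+-suc l))

interval-++ : ∀ {l m} → l ≤ m → interval 1 m ≡ interval 1 l ++ interval (suc l) m
interval-++ {l} {m} l≤m =
  trans (cong (applyUpTo suc) (sym (ℕₚ.m+[n∸m]≡n l≤m))) (applyUpTo-+ suc l (m ∸ l))

interval-> : ∀ l m → All (l <_) (interval (suc l) m)
interval-> l m = go (m ∸ l) λ i → s≤s (ℕₚ.m≤m+n l i)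
  where
  go : ∀ {f : ℕ → ℕ} n → (∀ i → l < f i) → All (l <_) (applyUpTo f n)
  go zero    _  = []
  go (suc n) lt = lt 0 ∷ go n (lt ∘ suc)

module _ (d : ℕ) .{{_ : NonZero d}} where

  length-multiples : ∀ n → length (filter (d ∣?_) (interval 1 n)) ≡ n / d
  length-multiples n = ℤₚ.+-injective (begin
    + length (filter (d ∣?_) (interval 1 n))       ≡⟨ length-filter (d ∣?_) (interval 1 n) ⟩
    sumℤ (map 𝟙d (interval 1 n))                   ≡⟨ sumℤ-interval 𝟙d n ⟩
    sumTo 𝟙d n                                     ≡⟨ cong (sumTo 𝟙d) n≡qd+r ⟩
    sumTo 𝟙d (q ℕ.* d ℕ.+ r)                        ≡⟨ sumTo-+-split 𝟙d (q ℕ.* d) r ⟩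
    sumTo 𝟙d (q ℕ.* d) + sumTo (λ i → 𝟙d (q ℕ.* d ℕ.+ i)) r ≡⟨ cong₂ _+_ full-blocks remainder ⟩
    + q + + 0                                       ≡⟨ ℤₚ.+-identityʳ (+ q) ⟩
    + q                                             ∎)
    where
    open ≡-Reasoning
    q : ℕ
    q = n / d
    r : ℕ
    r = n % d
    𝟙d : ℕ → ℤ
    𝟙d e = 𝟙 (d ∣? e)
    n≡qd+r : n ≡ q ℕ.* d ℕ.+ r
    n≡qd+r = trans (m≡m%n+[m/n]*n n d) (ℕₚ.+-comm r (q ℕ.* d))
    sumTo-one : ∀ k → sumTo (λ _ → + 1) k ≡ + k
    sumTo-one zero    = refl
    sumTo-one (suc k) rewrite sumTo-one k = ℤₚ.+-comm (+ k) (+ 1)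
    full-blocks : sumTo 𝟙d (q ℕ.* d) ≡ + q
    full-blocks = begin
      sumTo 𝟙d (q ℕ.* d)
        ≡⟨ sumTo-cong (q ℕ.* d) (λ _ _ _ → sym (ℤₚ.*-identityʳ _)) ⟩
      sumTo (λ e → 𝟙d e * + 1) (q ℕ.* d)           ≡⟨ sumTo-multiples d (λ _ → + 1) q ⟩
      sumTo (λ _ → + 1) q                           ≡⟨ sumTo-one q ⟩
      + q                                           ∎
    remainder : sumTo (λ i → 𝟙d (q ℕ.* d ℕ.+ i)) r ≡ + 0
    remainder = sumTo-zero r λ i 1≤i i≤r → 𝟙-no (d ∣? (q ℕ.* d ℕ.+ i)) λ d∣ →
      ℕₚ.<⇒≱ (ℕₚ.≤-<-trans i≤r (m%n<n n d)) (∣⇒≤ {{ℕ.>-nonZero 1≤i}} (∣m+n∣m⇒∣n d∣ (n∣m*n q)))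

  length-multiples-between : ∀ {l m} → l ≤ m → length (filter (d ∣?_) (interval (suc l) m)) ≡ m / d ∸ l / d
  length-multiples-between {l} {m} l≤m = begin
    c                       ≡⟨ sym (ℕₚ.m+n∸m≡n a c) ⟩
    a ℕ.+ c ∸ a             ≡⟨ cong (_∸ a) (sym length-upto-m) ⟩
    length (multiples (interval 1 m)) ∸ a ≡⟨ cong₂ _∸_ (length-multiples m) (length-multiples l) ⟩
    m / d ∸ l / d           ∎
    where
    open ≡-Reasoning
    multiples : List ℕ → List ℕ
    multiples = filter (d ∣?_)
    a : ℕ
    a = length (multiples (interval 1 l))
    c : ℕ
    c = length (multiples (interval (suc l) m))
    length-upto-m : length (multiples (interval 1 m)) ≡ a ℕ.+ c
    length-upto-m = begin
      length (multiples (interval 1 m))      ≡⟨ cong (length ∘ multiples) (interval-++ l≤m) ⟩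
      length (multiples (interval 1 l ++ interval (suc l) m))
        ≡⟨ cong length (Listₚ.filter-++ (d ∣?_) (interval 1 l) _) ⟩
      length (multiples (interval 1 l) ++ multiples (interval (suc l) m))
        ≡⟨ Listₚ.length-++ (multiples (interval 1 l)) ⟩
      a ℕ.+ c                                ∎

-- The Möbius function

prime≢1 : ∀ {p} → Prime p → p ≢ 1
prime≢1 pp refl = case prime⇒nonTrivial pp of λ ()

prime∣prime⇒≡ : ∀ {p q} → Prime p → Prime q → p ∣ q → p ≡ q
prime∣prime⇒≡ pp pq p∣q with prime⇒irreducible pq p∣q
... | inj₁ p≡1 = ⊥-elim (prime≢1 pp p≡1)
... | inj₂ p≡q = p≡q

module _ {p : ℕ} (pp : Prime p) where

  prime∤⇒coprime : ∀ {m} → ¬ p ∣ m → Coprime m p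
  prime∤⇒coprime p∤m (j∣m , j∣p) with prime⇒irreducible pp j∣p
  ... | inj₁ j≡1 = j≡1
  ... | inj₂ refl = ⊥-elim (p∤m j∣m)

  prime∤square : ∀ {q} → Prime q → q ≢ p → ¬ p ∣ q ℕ.* q
  prime∤square pq q≢p p∣qq = q≢p (sym (prime∣prime⇒≡ pp pq (reduce (euclidsLemma _ _ pp p∣qq))))

  prime∣*prime⇒∣ : ∀ {q i} → Prime q → q ≢ p → q ∣ i ℕ.* p → q ∣ i
  prime∣*prime⇒∣ pq q≢p q∣ip with euclidsLemma _ _ pq q∣ip
  ... | inj₁ q∣i = q∣i
  ... | inj₂ q∣p = ⊥-elim (q≢p (prime∣prime⇒≡ pq pp q∣p))

isPrimeDivisor? : ∀ n x → Dec (Prime x × x ∣ n)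
isPrimeDivisor? n x = prime? x ×-dec (x ∣? n)

∈-primeDivisors⁺ : ∀ {n x} .{{_ : NonZero n}} → Prime x → x ∣ n → x ∈ primeDivisors n
∈-primeDivisors⁺ {n} {suc x} px x∣n =
  ∈-filter⁺ (isPrimeDivisor? n) (∈-applyUpTo⁺ (1 ℕ.+_) (∣⇒≤ x∣n)) (px , x∣n)
∈-primeDivisors⁺ {x = zero} p0 _ = case prime⇒nonZero p0 of λ ()

∈-primeDivisors⁻ : ∀ {n x} → x ∈ primeDivisors n → Prime x × x ∣ n
∈-primeDivisors⁻ {n} x∈ = proj₂ (∈-filter⁻ (isPrimeDivisor? n) {xs = interval 1 n} x∈)

hasSquareFactor⁺ : ∀ {n q} .{{_ : NonZero n}} → Prime q → q ℕ.* q ∣ n → hasSquareFactor n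
hasSquareFactor⁺ {n} pq qq∣n = lose {xs = primeDivisors n} (∈-primeDivisors⁺ pq (∣-trans (m∣m*n _) qq∣n)) qq∣n

hasSquareFactor⁻ : ∀ {n} → hasSquareFactor n → ∃ λ q → Prime q × q ℕ.* q ∣ n
hasSquareFactor⁻ {n} sq with find {xs = primeDivisors n} sq
... | q , q∈ , qq∣n = q , proj₁ (∈-primeDivisors⁻ {n} q∈) , qq∣n

μ-squareful : ∀ n → hasSquareFactor n → μ n ≡ + 0
μ-squareful n sq with hasSquareFactor? n
... | yes _  = refl
... | no ¬sq = ⊥-elim (¬sq sq)

μ-squarefree : ∀ n → ¬ hasSquareFactor n → μ n ≡ signPow (length (primeDivisors n))
μ-squarefree n ¬sq with hasSquareFactor? n
... | yes sq = ⊥-elim (¬sq sq)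
... | no _   = refl

sumTo-𝟙-≡ : ∀ {p n} → 1 ≤ p → p ≤ n → sumTo (λ x → 𝟙 (x ℕ.≟ p)) n ≡ + 1
sumTo-𝟙-≡ {suc p} {n} _ p≤n = begin
  sumTo 𝟙p n                       ≡⟨ sumTo-truncate 𝟙p p≤n (λ x p<x _ → 𝟙-no (x ℕ.≟ suc p) (ℕₚ.>⇒≢ p<x)) ⟩
  sumTo 𝟙p p + 𝟙 (suc p ℕ.≟ suc p) ≡⟨ cong₂ _+_ (sumTo-zero p λ x _ x≤p → 𝟙-no (x ℕ.≟ suc p) (ℕₚ.<⇒≢ (s≤s x≤p)))
                                                  (𝟙-yes (suc p ℕ.≟ suc p) refl) ⟩
  + 1                              ∎
  where
  open ≡-Reasoning
  𝟙p : ℕ → ℤ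
  𝟙p x = 𝟙 (x ℕ.≟ suc p)

module _ {i p : ℕ} .{{_ : NonZero i}} (pp : Prime p) (p∤i : ¬ p ∣ i) where

  private instance
    p≢0 : NonZero p
    p≢0 = prime⇒nonZero pp
    ip≢0 : NonZero (i ℕ.* p)
    ip≢0 = ℕₚ.m*n≢0 i p

  𝟙-isPrimeDivisor-*prime : ∀ x → 𝟙 (isPrimeDivisor? (i ℕ.* p) x) ≡ 𝟙 (isPrimeDivisor? i x) + 𝟙 (x ℕ.≟ p)
  𝟙-isPrimeDivisor-*prime x with x ℕ.≟ p
  ... | yes refl rewrite 𝟙-yes (isPrimeDivisor? (i ℕ.* p) p) (pp , n∣m*n i)
                       | 𝟙-no (isPrimeDivisor? i p) (p∤i ∘ proj₂) = refl
  ... | no x≢p = trans (𝟙-cong (isPrimeDivisor? (i ℕ.* p) x) (isPrimeDivisor? i x)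
                          (λ (px , x∣ip) → px , prime∣*prime⇒∣ pp px x≢p x∣ip)
                          (λ (px , x∣i) → px , ∣m⇒∣m*n p x∣i))
                       (sym (ℤₚ.+-identityʳ _))

  length-primeDivisors-*prime : length (primeDivisors (i ℕ.* p)) ≡ suc (length (primeDivisors i))
  length-primeDivisors-*prime = ℤₚ.+-injective (begin
    + length (primeDivisors (i ℕ.* p))         ≡⟨ count (i ℕ.* p) ⟩
    sumTo (PD (i ℕ.* p)) (i ℕ.* p)             ≡⟨ sumTo-cong (i ℕ.* p) (λ x _ _ → 𝟙-isPrimeDivisor-*prime x) ⟩
    sumTo (λ x → PD i x + 𝟙 (x ℕ.≟ p)) (i ℕ.* p) ≡⟨ sumTo-+ (i ℕ.* p) ⟩
    sumTo (PD i) (i ℕ.* p) + sumTo (λ x → 𝟙 (x ℕ.≟ p)) (i ℕ.* p)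
      ≡⟨ cong₂ _+_ (sumTo-truncate (PD i) (ℕₚ.m≤m*n i p) λ x i<x _ →
                      𝟙-no (isPrimeDivisor? i x) (ℕₚ.<⇒≱ i<x ∘ ∣⇒≤ ∘ proj₂))
                   (sumTo-𝟙-≡ (ℕ.>-nonZero⁻¹ p) (ℕₚ.m≤n*m p i)) ⟩
    sumTo (PD i) i + + 1                       ≡⟨ cong (_+ + 1) (sym (count i)) ⟩
    + length (primeDivisors i) + + 1           ≡⟨ ℤₚ.+-comm (+ length (primeDivisors i)) (+ 1) ⟩
    + suc (length (primeDivisors i))           ∎)
    where
    open ≡-Reasoning
    PD : ℕ → ℕ → ℤ
    PD n = 𝟙 ∘ isPrimeDivisor? n
    count : ∀ n → + length (primeDivisors n) ≡ sumTo (PD n) n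
    count n = trans (length-filter (isPrimeDivisor? n) (interval 1 n)) (sumℤ-interval (PD n) n)

  squarefree-*prime : ¬ hasSquareFactor i → ¬ hasSquareFactor (i ℕ.* p)
  squarefree-*prime ¬sq sq with hasSquareFactor⁻ {i ℕ.* p} sq
  ... | q , pq , qq∣ip with q ℕ.≟ p
  ...   | yes refl = p∤i (*-cancelʳ-∣ p qq∣ip)
  ...   | no q≢p   = ¬sq (hasSquareFactor⁺ pq (coprime-divisor (prime∤⇒coprime pp (prime∤square pp pq q≢p))
                                                               (subst (q ℕ.* q ∣_) (ℕₚ.*-comm i p) qq∣ip)))

  μ-*prime-∤ : μ (i ℕ.* p) ≡ - μ i
  μ-*prime-∤ = by-cases (hasSquareFactor? i)
    where
    by-cases : Dec (hasSquareFactor i) → μ (i ℕ.* p) ≡ - μ i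
    by-cases (yes sq) = let q , pq , qq∣i = hasSquareFactor⁻ {i} sq in begin
      μ (i ℕ.* p) ≡⟨ μ-squareful (i ℕ.* p) (hasSquareFactor⁺ pq (∣m⇒∣m*n p qq∣i)) ⟩
      + 0         ≡⟨ cong -_ (sym (μ-squareful i sq)) ⟩
      - μ i       ∎
      where open ≡-Reasoning
    by-cases (no ¬sq) rewrite μ-squarefree i ¬sq
                            | μ-squarefree (i ℕ.* p) (squarefree-*prime ¬sq)
                            | length-primeDivisors-*prime = refl

μ-*prime-∣ : ∀ {i p} .{{_ : NonZero i}} → Prime p → p ∣ i → μ (i ℕ.* p) ≡ + 0
μ-*prime-∣ {i} {p} pp p∣i = μ-squareful (i ℕ.* p) (hasSquareFactor⁺ pp (*-monoˡ-∣ p p∣i))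
  where instance
  p≢0 : NonZero p
  p≢0 = prime⇒nonZero pp
  ip≢0 : NonZero (i ℕ.* p)
  ip≢0 = ℕₚ.m*n≢0 i p

prime-factor : ∀ n .{{_ : NonTrivial n}} → ∃ λ p → Prime p × p ∣ n
prime-factor n@(2+ _) with factorise n
... | record { factors = p ∷ ps ; isFactorisation = n≡Πps ; factorsPrime = pp ∷ _ } =
  p , pp , subst (p ∣_) (sym n≡Πps) (m∣m*n (product ps))

module _ {q p : ℕ} .{{_ : NonZero q}} (pp : Prime p) where

  private
    instance
      p≢0 : NonZero p
      p≢0 = prime⇒nonZero pp

    n : ℕ
    n = q ℕ.* p

    μ∣n μ∣n∤p : ℕ → ℤ
    μ∣n d = 𝟙 (d ∣? n) * μ d
    μ∣n∤p d = 𝟙 (¬? (p ∣? d)) * μ∣n d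

  ∣*prime⇒∣ : ∀ {d} → ¬ p ∣ d → d ∣ q ℕ.* p → d ∣ q
  ∣*prime⇒∣ {d} p∤d d∣qp =
    coprime-divisor (prime∤⇒coprime pp p∤d) (subst (d ∣_) (ℕₚ.*-comm q p) d∣qp)

  private
    μ∣n-*prime : ∀ i → 1 ≤ i → μ∣n (i ℕ.* p) ≡ - μ∣n∤p i
    μ∣n-*prime i 1≤i with p ∣? i
    ... | yes p∣i rewrite μ-*prime-∣ {{ℕ.>-nonZero 1≤i}} pp p∣i = ℤₚ.*-zeroʳ (𝟙 ((i ℕ.* p) ∣? n))
    ... | no p∤i rewrite μ-*prime-∤ {{ℕ.>-nonZero 1≤i}} pp p∤i
                       | 𝟙-cong ((i ℕ.* p) ∣? n) (i ∣? n)
                           (∣m⇒∣m*n p ∘ *-cancelʳ-∣ {i} {q} p) (*-monoˡ-∣ p ∘ ∣*prime⇒∣ p∤i)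
                       = pull-out-sign (𝟙 (i ∣? n)) (μ i)
      where
      pull-out-sign : ∀ a b → a * - b ≡ - (+ 1 * (a * b))
      pull-out-sign = solve-∀

    μ∣n∤p-vanishes : ∀ d → q < d → μ∣n∤p d ≡ + 0
    μ∣n∤p-vanishes d q<d with p ∣? d
    ... | yes _  = refl
    ... | no p∤d rewrite 𝟙-no (d ∣? n) (ℕₚ.<⇒≱ q<d ∘ ∣⇒≤ ∘ ∣*prime⇒∣ p∤d) = refl

  sumTo-μ-divisors-*prime : sumTo (λ d → 𝟙 (d ∣? q ℕ.* p) * μ d) (q ℕ.* p) ≡ + 0
  sumTo-μ-divisors-*prime = begin
    sumTo μ∣n n                                            ≡⟨ sumTo-partition (p ∣?_) μ∣n n ⟩
    sumTo (λ d → 𝟙 (p ∣? d) * μ∣n d) n + sumTo μ∣n∤p n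
      ≡⟨ cong₂ _+_ (sumTo-multiples p μ∣n q)
                   (sumTo-truncate μ∣n∤p (ℕₚ.m≤m*n q p) λ d q<d _ → μ∣n∤p-vanishes d q<d) ⟩
    sumTo (λ i → μ∣n (i ℕ.* p)) q + sumTo μ∣n∤p q
      ≡⟨ cong (_+ sumTo μ∣n∤p q) (sumTo-cong q λ i 1≤i _ → μ∣n-*prime i 1≤i) ⟩
    sumTo (λ i → - μ∣n∤p i) q + sumTo μ∣n∤p q              ≡⟨ cong (_+ sumTo μ∣n∤p q) (sumTo-neg μ∣n∤p q) ⟩
    - sumTo μ∣n∤p q + sumTo μ∣n∤p q                        ≡⟨ ℤₚ.+-inverseˡ (sumTo μ∣n∤p q) ⟩
    + 0                                                    ∎
    where open ≡-Reasoning

μ-sum-divisors : ∀ n .{{_ : NonZero n}} → sumTo (λ d → 𝟙 (d ∣? n) * μ d) n ≡ 𝟙 (n ℕ.≟ 1)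
μ-sum-divisors 1 = refl
μ-sum-divisors n@(2+ _) with prime-factor n
... | p , pp , divides (suc q) n≡qp =
  subst (λ m → sumTo (λ d → 𝟙 (d ∣? m) * μ d) m ≡ + 0) (sym n≡qp) (sumTo-μ-divisors-*prime {suc q} pp)

divisor-nonZero : ∀ {g l} .{{_ : NonZero l}} → g ∣ l → NonZero g
divisor-nonZero {suc _}     _   = _
divisor-nonZero {zero}  {l} 0∣l = ⊥-elim (ℕ.≢-nonZero⁻¹ l (0∣⇒≡0 0∣l))

μ-sum-common-divisors : ∀ {g l} .{{_ : NonZero l}} → g ∣ l →
  sumℤ (map (λ d → 𝟙 (d ∣? g) * μ d) (divisors l)) ≡ 𝟙 (g ℕ.≟ 1)
μ-sum-common-divisors {g} {l} g∣l = begin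
  sumℤ (map M (divisors l))                 ≡⟨ sumℤ-divisors M l ⟩
  sumTo (λ d → 𝟙 (d ∣? l) * M d) l          ≡⟨ sumTo-cong l (λ d _ _ → 𝟙-∣-absorb d) ⟩
  sumTo M l
    ≡⟨ sumTo-truncate M (∣⇒≤ g∣l) (λ d g<d _ → cong (_* μ d) (𝟙-no (d ∣? g) (ℕₚ.<⇒≱ g<d ∘ ∣⇒≤))) ⟩
  sumTo M g                                 ≡⟨ μ-sum-divisors g ⟩
  𝟙 (g ℕ.≟ 1)                               ∎
  where
  open ≡-Reasoning
  instance
    g≢0 : NonZero g
    g≢0 = divisor-nonZero g∣l
  M : ℕ → ℤ
  M d = 𝟙 (d ∣? g) * μ d
  𝟙-∣-absorb : ∀ d → 𝟙 (d ∣? l) * M d ≡ M d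
  𝟙-∣-absorb d with d ∣? g
  ... | yes d∣g rewrite 𝟙-yes (d ∣? l) (∣-trans d∣g g∣l) = ℤₚ.*-identityˡ _
  ... | no _    = ℤₚ.*-zeroʳ (𝟙 (d ∣? l))

-- Sums over subsets

sumℤ-powerset-∷ : ∀ (F : List ℕ → ℤ) y ys →
  sumℤ (map F (powerset (y ∷ ys))) ≡ sumℤ (map F (powerset ys)) + sumℤ (map (F ∘ (y ∷_)) (powerset ys))
sumℤ-powerset-∷ F y ys = begin
  sumℤ (map F (powerset ys ++ map (y ∷_) (powerset ys)))
    ≡⟨ cong sumℤ (Listₚ.map-++ F (powerset ys) _) ⟩
  sumℤ (map F (powerset ys) ++ map F (map (y ∷_) (powerset ys))) ≡⟨ sumℤ-++ (map F (powerset ys)) _ ⟩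
  sumℤ (map F (powerset ys)) + sumℤ (map F (map (y ∷_) (powerset ys)))
    ≡⟨ cong (λ z → sumℤ (map F (powerset ys)) + sumℤ z) (sym (Listₚ.map-∘ (powerset ys))) ⟩
  sumℤ (map F (powerset ys)) + sumℤ (map (F ∘ (y ∷_)) (powerset ys)) ∎
  where open ≡-Reasoning

powerset⁺ : ∀ {P : ℕ → Set} {ys} → All P ys → All (All P) (powerset ys)
powerset⁺ []         = [] ∷ []
powerset⁺ (py ∷ pys) = All.++⁺ (powerset⁺ pys) (All.map⁺ (All.map (py ∷_) (powerset⁺ pys)))

sumℤ-powerset-∋ : ∀ (F : List ℕ → ℤ) {y ys} → y ∉ ys →
  sumℤ (map (λ X → 𝟙 (y ∈? X) * F X) (powerset (y ∷ ys))) ≡ sumℤ (map (F ∘ (y ∷_)) (powerset ys))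
sumℤ-powerset-∋ F {y} {ys} y∉ys = begin
  sumℤ (map G (powerset (y ∷ ys)))                                    ≡⟨ sumℤ-powerset-∷ G y ys ⟩
  sumℤ (map G (powerset ys)) + sumℤ (map (G ∘ (y ∷_)) (powerset ys))
    ≡⟨ cong₂ _+_ (sumℤ-zero (powerset ys) λ X∈ → cong (_* F _) (𝟙-no (y ∈? _) (All.All¬⇒¬Any (All.lookup y∉ys* X∈))))
                 (sumℤ-cong (powerset ys) λ {X} _ → cong (_* F (y ∷ X)) (𝟙-yes (y ∈? (y ∷ X)) (here refl))) ⟩
  + 0 + sumℤ (map (λ X → + 1 * F (y ∷ X)) (powerset ys))               ≡⟨ ℤₚ.+-identityˡ _ ⟩
  sumℤ (map (λ X → + 1 * F (y ∷ X)) (powerset ys))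
    ≡⟨ sumℤ-cong (powerset ys) (λ _ → ℤₚ.*-identityˡ _) ⟩
  sumℤ (map (F ∘ (y ∷_)) (powerset ys))                                 ∎
  where
  open ≡-Reasoning
  G : List ℕ → ℤ
  G X = 𝟙 (y ∈? X) * F X
  y∉ys* : All (All (λ x → ¬ y ≡ x)) (powerset ys)
  y∉ys* = powerset⁺ (All.¬Any⇒All¬ ys y∉ys)

module _ {P : ℕ → Set} (P? : ∀ x → Dec (P x)) where

  𝟙-all?-∷ : ∀ {y} → P y → ∀ X → 𝟙 (all? P? (y ∷ X)) ≡ 𝟙 (all? P? X)
  𝟙-all?-∷ py X = 𝟙-cong (all? P? (_ ∷ X)) (all? P? X) All.tail (py ∷_)

  𝟙-all?-∷-vanishes : ∀ {y} → ¬ P y → ∀ X → 𝟙 (all? P? (y ∷ X)) ≡ + 0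
  𝟙-all?-∷-vanishes ¬py X = 𝟙-no (all? P? (_ ∷ X)) (¬py ∘ All.head)

  sumℤ-powerset-all : ∀ ys → sumℤ (map (𝟙 ∘ all? P?) (powerset ys)) ≡ + (2 ^ length (filter P? ys))
  sumℤ-powerset-all []       = refl
  sumℤ-powerset-all (y ∷ ys) with P? y
  ... | yes py = begin
    sumℤ (map (𝟙 ∘ all? P?) (powerset (y ∷ ys)))   ≡⟨ sumℤ-powerset-∷ (𝟙 ∘ all? P?) y ys ⟩
    S + sumℤ (map (λ X → 𝟙 (all? P? (y ∷ X))) (powerset ys))
      ≡⟨ cong₂ _+_ (sumℤ-powerset-all ys)
                   (trans (sumℤ-cong (powerset ys) λ {X} _ → 𝟙-all?-∷ py X) (sumℤ-powerset-all ys)) ⟩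
    + (2 ^ c) + + (2 ^ c)                          ≡⟨ cong (λ z → + (2 ^ c ℕ.+ z)) (sym (ℕₚ.+-identityʳ _)) ⟩
    + (2 ^ suc c)                                  ∎
    where
    open ≡-Reasoning
    c : ℕ
    c = length (filter P? ys)
    S : ℤ
    S = sumℤ (map (𝟙 ∘ all? P?) (powerset ys))
  ... | no ¬py = begin
    sumℤ (map (𝟙 ∘ all? P?) (powerset (y ∷ ys)))   ≡⟨ sumℤ-powerset-∷ (𝟙 ∘ all? P?) y ys ⟩
    S + sumℤ (map (λ X → 𝟙 (all? P? (y ∷ X))) (powerset ys))
      ≡⟨ cong (_+_ S) (sumℤ-zero (powerset ys) λ {X} _ → 𝟙-all?-∷-vanishes ¬py X) ⟩
    S + + 0                                        ≡⟨ ℤₚ.+-identityʳ S ⟩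
    S                                              ≡⟨ sumℤ-powerset-all ys ⟩
    + (2 ^ length (filter P? ys))                  ∎
    where
    open ≡-Reasoning
    S : ℤ
    S = sumℤ (map (𝟙 ∘ all? P?) (powerset ys))

  sumℤ-powerset-all-length : ∀ ys j →
    sumℤ (map (λ X → 𝟙 (length X ℕ.≟ j) * 𝟙 (all? P? X)) (powerset ys)) ≡ + (length (filter P? ys) C j)
  sumℤ-powerset-all-length []       zero    = refl
  sumℤ-powerset-all-length []       (suc j) = refl
  sumℤ-powerset-all-length (y ∷ ys) j with P? y
  ... | yes py = begin
    sumℤ (map (W j) (powerset (y ∷ ys)))                          ≡⟨ sumℤ-powerset-∷ (W j) y ys ⟩
    sumℤ (map (W j) (powerset ys)) + sumℤ (map (W j ∘ (y ∷_)) (powerset ys))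
      ≡⟨ cong₂ _+_ (sumℤ-powerset-all-length ys j)
                   (sumℤ-cong (powerset ys) λ {X} _ → cong (𝟙 (suc (length X) ℕ.≟ j) *_) (𝟙-all?-∷ py X)) ⟩
    + (c C j) + sumℤ (map (W′ j) (powerset ys))                   ≡⟨ pascal j ⟩
    + (suc c C j)                                                 ∎
    where
    open ≡-Reasoning
    c : ℕ
    c = length (filter P? ys)
    W W′ : ℕ → List ℕ → ℤ
    W  j X = 𝟙 (length X ℕ.≟ j) * 𝟙 (all? P? X)
    W′ j X = 𝟙 (suc (length X) ℕ.≟ j) * 𝟙 (all? P? X)
    pascal : ∀ j → + (c C j) + sumℤ (map (W′ j) (powerset ys)) ≡ + (suc c C j)
    pascal zero    = cong (_+_ (+ (c C 0))) (sumℤ-zero (powerset ys) λ _ → refl)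
    pascal (suc j) = begin
      + (c C suc j) + sumℤ (map (W′ (suc j)) (powerset ys))
        ≡⟨ cong (_+_ (+ (c C suc j))) (sumℤ-cong (powerset ys) λ {X} _ →
             cong (_* 𝟙 (all? P? X)) (𝟙-suc-≟ (length X) j)) ⟩
      + (c C suc j) + sumℤ (map (W j) (powerset ys))
        ≡⟨ cong (_+_ (+ (c C suc j))) (sumℤ-powerset-all-length ys j) ⟩
      + (c C suc j ℕ.+ c C j)                         ≡⟨ cong +_ (ℕₚ.+-comm (c C suc j) (c C j)) ⟩
      + (c C j ℕ.+ c C suc j)                         ≡⟨ cong +_ (nCk+nC[k+1]≡[n+1]C[k+1] c j) ⟩
      + (suc c C suc j)                               ∎
  ... | no ¬py = begin
    sumℤ (map (W j) (powerset (y ∷ ys)))                          ≡⟨ sumℤ-powerset-∷ (W j) y ys ⟩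
    sumℤ (map (W j) (powerset ys)) + sumℤ (map (W j ∘ (y ∷_)) (powerset ys))
      ≡⟨ cong₂ _+_ (sumℤ-powerset-all-length ys j)
                   (sumℤ-zero (powerset ys) λ {X} _ →
                      trans (cong (𝟙 (suc (length X) ℕ.≟ j) *_) (𝟙-all?-∷-vanishes ¬py X))
                            (ℤₚ.*-zeroʳ (𝟙 (suc (length X) ℕ.≟ j)))) ⟩
    + (length (filter P? ys) C j) + + 0                           ≡⟨ ℤₚ.+-identityʳ _ ⟩
    + (length (filter P? ys) C j)                                 ∎
    where
    open ≡-Reasoning
    W : ℕ → List ℕ → ℤ
    W j X = 𝟙 (length X ℕ.≟ j) * 𝟙 (all? P? X)

-- Subsets with gcd 1

gcdList-∣ : ∀ {x} X → x ∈ X → gcdList X ∣ x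
gcdList-∣ (y ∷ X) (here refl) = gcd[m,n]∣m y (gcdList X)
gcdList-∣ (y ∷ X) (there x∈X) = ∣-trans (gcd[m,n]∣n y (gcdList X)) (gcdList-∣ X x∈X)

∣gcdList⇒All : ∀ {d} X → d ∣ gcdList X → All (d ∣_) X
∣gcdList⇒All X d∣g = All.tabulate λ x∈X → ∣-trans d∣g (gcdList-∣ X x∈X)

All⇒∣gcdList : ∀ {d} X → All (d ∣_) X → d ∣ gcdList X
All⇒∣gcdList []      []           = _ ∣0
All⇒∣gcdList (_ ∷ X) (d∣x ∷ d∣X) = gcd-greatest d∣x (All⇒∣gcdList X d∣X)

𝟙-gcdList≡1 : ∀ {l X} .{{_ : NonZero l}} → l ∈ X →
  𝟙 (gcdList X ℕ.≟ 1) ≡ sumℤ (map (λ d → μ d * 𝟙 (all? (d ∣?_) X)) (divisors l))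
𝟙-gcdList≡1 {l} {X} l∈X = begin
  𝟙 (gcdList X ℕ.≟ 1)
    ≡⟨ sym (μ-sum-common-divisors (gcdList-∣ X l∈X)) ⟩
  sumℤ (map (λ d → 𝟙 (d ∣? gcdList X) * μ d) (divisors l))
    ≡⟨ sumℤ-cong (divisors l) (λ {d} _ → swap-factors d) ⟩
  sumℤ (map (λ d → μ d * 𝟙 (all? (d ∣?_) X)) (divisors l))     ∎
  where
  open ≡-Reasoning
  swap-factors : ∀ d → 𝟙 (d ∣? gcdList X) * μ d ≡ μ d * 𝟙 (all? (d ∣?_) X)
  swap-factors d = trans (ℤₚ.*-comm _ (μ d))
    (cong (μ d *_) (𝟙-cong (d ∣? gcdList X) (all? (d ∣?_) X) (∣gcdList⇒All X) (All⇒∣gcdList X)))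

∈-divisors⇒∣ : ∀ {d n} → d ∈ divisors n → d ∣ n
∈-divisors⇒∣ {n = n} d∈ = proj₂ (∈-filter⁻ (_∣? n) {xs = interval 1 n} d∈)

length-divisor-multiples-between : ∀ {d l m} → d ∈ divisors l → l ≤ m →
  length (filter (d ∣?_) (interval (suc l) m)) ≡ m div d ∸ l div d
length-divisor-multiples-between {suc e} _ l≤m = length-multiples-between (suc e) l≤m
-- the elements of divisors l lie in [1, l]
length-divisor-multiples-between {zero} {l} 0∈ _
  with ∈-applyUpTo⁻ suc (proj₁ (∈-filter⁻ (_∣? l) {xs = interval 1 l} 0∈))
... | _ , _ , ()

module _ {l m : ℕ} .{{_ : NonZero l}} (l≤m : l ≤ m) (w : List ℕ → ℤ) where

  private
    ys : List ℕ
    ys = interval (suc l) m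

    l∉ys : l ∉ ys
    l∉ys l∈ys = ℕₚ.<-irrefl refl (All.lookup (interval-> l m) l∈ys)

    𝟙-∣all : ℕ → List ℕ → ℤ
    𝟙-∣all d X = 𝟙 (all? (d ∣?_) X)

  𝟙-gcdList≡1-weighted : ∀ X →
    𝟙 (l ∈? X) * (w X * 𝟙 (gcdList X ℕ.≟ 1))
      ≡ sumℤ (map (λ d → μ d * (𝟙 (l ∈? X) * (w X * 𝟙-∣all d X))) (divisors l))
  𝟙-gcdList≡1-weighted X = begin
    𝟙 (l ∈? X) * (w X * 𝟙 (gcdList X ℕ.≟ 1))
      ≡⟨ 𝟙-*-cong (l ∈? X) (cong (w X *_) ∘ 𝟙-gcdList≡1) ⟩
    𝟙 (l ∈? X) * (w X * sumℤ (map (λ d → μ d * 𝟙-∣all d X) (divisors l)))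
      ≡⟨ cong (𝟙 (l ∈? X) *_) (sym (sumℤ-*ˡ (w X) _ (divisors l))) ⟩
    𝟙 (l ∈? X) * sumℤ (map (λ d → w X * (μ d * 𝟙-∣all d X)) (divisors l))
      ≡⟨ sym (sumℤ-*ˡ (𝟙 (l ∈? X)) _ (divisors l)) ⟩
    sumℤ (map (λ d → 𝟙 (l ∈? X) * (w X * (μ d * 𝟙-∣all d X))) (divisors l))
      ≡⟨ sumℤ-cong (divisors l) (λ {d} _ → rearrange (𝟙 (l ∈? X)) (w X) (μ d) (𝟙-∣all d X)) ⟩
    sumℤ (map (λ d → μ d * (𝟙 (l ∈? X) * (w X * 𝟙-∣all d X))) (divisors l)) ∎
    where
    open ≡-Reasoning
    rearrange : ∀ a b c e → a * (b * (c * e)) ≡ c * (a * (b * e))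
    rearrange = solve-∀

  sumℤ-subsets-∋-∣all : ∀ {d} → d ∣ l →
    sumℤ (map (λ X → 𝟙 (l ∈? X) * (w X * 𝟙-∣all d X)) (powerset (interval l m)))
      ≡ sumℤ (map (λ X → w (l ∷ X) * 𝟙-∣all d X) (powerset ys))
  sumℤ-subsets-∋-∣all {d} d∣l = begin
    sumℤ (map (λ X → 𝟙 (l ∈? X) * (w X * 𝟙-∣all d X)) (powerset (interval l m)))
      ≡⟨ cong (λ Y → sumℤ (map (λ X → 𝟙 (l ∈? X) * (w X * 𝟙-∣all d X)) (powerset Y))) (interval-∷ l≤m) ⟩
    sumℤ (map (λ X → 𝟙 (l ∈? X) * (w X * 𝟙-∣all d X)) (powerset (l ∷ ys)))
      ≡⟨ sumℤ-powerset-∋ (λ X → w X * 𝟙-∣all d X) l∉ys ⟩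
    sumℤ (map (λ X → w (l ∷ X) * 𝟙-∣all d (l ∷ X)) (powerset ys))
      ≡⟨ sumℤ-cong (powerset ys) (λ {X} _ → cong (w (l ∷ X) *_) (𝟙-all?-∷ (d ∣?_) d∣l X)) ⟩
    sumℤ (map (λ X → w (l ∷ X) * 𝟙-∣all d X) (powerset ys)) ∎
    where open ≡-Reasoning

  sumℤ-subsets-∋-gcd≡1 :
    sumℤ (map (λ X → 𝟙 (l ∈? X) * (w X * 𝟙 (gcdList X ℕ.≟ 1))) (powerset (interval l m)))
      ≡ sumℤ (map (λ d → μ d * sumℤ (map (λ X → w (l ∷ X) * 𝟙-∣all d X) (powerset ys))) (divisors l))
  sumℤ-subsets-∋-gcd≡1 = begin
    sumℤ (map (λ X → 𝟙 (l ∈? X) * (w X * 𝟙 (gcdList X ℕ.≟ 1))) PS)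
      ≡⟨ sumℤ-cong PS (λ {X} _ → 𝟙-gcdList≡1-weighted X) ⟩
    sumℤ (map (λ X → sumℤ (map (λ d → μ d * T d X) (divisors l))) PS)
      ≡⟨ sumℤ-swap (λ X d → μ d * T d X) PS (divisors l) ⟩
    sumℤ (map (λ d → sumℤ (map (λ X → μ d * T d X) PS)) (divisors l))
      ≡⟨ sumℤ-cong (divisors l) (λ {d} d∈ → trans (sumℤ-*ˡ (μ d) (T d) PS)
                                                  (cong (μ d *_) (sumℤ-subsets-∋-∣all (∈-divisors⇒∣ d∈)))) ⟩
    sumℤ (map (λ d → μ d * sumℤ (map (λ X → w (l ∷ X) * 𝟙-∣all d X) (powerset ys))) (divisors l)) ∎
    where
    open ≡-Reasoning
    PS : List (List ℕ)
    PS = powerset (interval l m)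
    T : ℕ → List ℕ → ℤ
    T d X = 𝟙 (l ∈? X) * (w X * 𝟙-∣all d X)

module _ {l m : ℕ} .{{_ : NonZero l}} (l≤m : l ≤ m) where

  private
    ys : List ℕ
    ys = interval (suc l) m
    PS : List (List ℕ)
    PS = powerset (interval l m)

  h1-formula : + h1 l m ≡ sumℤ (map (λ d → μ d * + (2 ^ (m div d ∸ l div d))) (divisors l))
  h1-formula = begin
    + h1 l m                                                        ≡⟨ length-filter P? PS ⟩
    sumℤ (map (𝟙 ∘ P?) PS)                                          ≡⟨ sumℤ-cong PS (λ {X} _ → unfold X) ⟩
    sumℤ (map (λ X → 𝟙 (l ∈? X) * (+ 1 * 𝟙 (gcdList X ℕ.≟ 1))) PS) ≡⟨ sumℤ-subsets-∋-gcd≡1 l≤m (λ _ → + 1) ⟩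
    sumℤ (map (λ d → μ d * sumℤ (map (λ X → + 1 * 𝟙 (all? (d ∣?_) X)) (powerset ys))) (divisors l))
      ≡⟨ sumℤ-cong (divisors l) (λ {d} d∈ → cong (μ d *_) (count d∈)) ⟩
    sumℤ (map (λ d → μ d * + (2 ^ (m div d ∸ l div d))) (divisors l)) ∎
    where
    open ≡-Reasoning
    P? : ∀ X → Dec (l ∈ X × gcdList X ≡ 1)
    P? = λ X → (l ∈? X) ×-dec (gcdList X ℕ.≟ 1)
    unfold : ∀ X → 𝟙 (P? X) ≡ 𝟙 (l ∈? X) * (+ 1 * 𝟙 (gcdList X ℕ.≟ 1))
    unfold X = trans (𝟙-×-dec (l ∈? X) _) (cong (𝟙 (l ∈? X) *_) (sym (ℤₚ.*-identityˡ _)))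
    count : ∀ {d} → d ∈ divisors l →
      sumℤ (map (λ X → + 1 * 𝟙 (all? (d ∣?_) X)) (powerset ys)) ≡ + (2 ^ (m div d ∸ l div d))
    count {d} d∈ = begin
      sumℤ (map (λ X → + 1 * 𝟙 (all? (d ∣?_) X)) (powerset ys))
        ≡⟨ sumℤ-cong (powerset ys) (λ _ → ℤₚ.*-identityˡ _) ⟩
      sumℤ (map (𝟙 ∘ all? (d ∣?_)) (powerset ys))              ≡⟨ sumℤ-powerset-all (d ∣?_) ys ⟩
      + (2 ^ length (filter (d ∣?_) ys))
        ≡⟨ cong (λ e → + (2 ^ e)) (length-divisor-multiples-between d∈ l≤m) ⟩
      + (2 ^ (m div d ∸ l div d))                              ∎

  h1k-formula : ∀ k → 1 ≤ k → + h1k k l m ≡ sumℤ (map (λ d → μ d * + ((m div d ∸ l div d) C (k ∸ 1))) (divisors l))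
  h1k-formula k@(suc j) _ = begin
    + h1k k l m                                                     ≡⟨ length-filter P? PS ⟩
    sumℤ (map (𝟙 ∘ P?) PS)                                          ≡⟨ sumℤ-cong PS (λ {X} _ → unfold X) ⟩
    sumℤ (map (λ X → 𝟙 (l ∈? X) * (𝟙 (length X ℕ.≟ k) * 𝟙 (gcdList X ℕ.≟ 1))) PS)
      ≡⟨ sumℤ-subsets-∋-gcd≡1 l≤m (λ X → 𝟙 (length X ℕ.≟ k)) ⟩
    sumℤ (map (λ d → μ d * sumℤ (map (λ X → 𝟙 (suc (length X) ℕ.≟ k) * 𝟙 (all? (d ∣?_) X)) (powerset ys)))
              (divisors l))
      ≡⟨ sumℤ-cong (divisors l) (λ {d} d∈ → cong (μ d *_) (count d∈)) ⟩
    sumℤ (map (λ d → μ d * + ((m div d ∸ l div d) C j)) (divisors l)) ∎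
    where
    open ≡-Reasoning
    P? : ∀ X → Dec (l ∈ X × length X ≡ k × gcdList X ≡ 1)
    P? = λ X → (l ∈? X) ×-dec ((length X ℕ.≟ k) ×-dec (gcdList X ℕ.≟ 1))
    unfold : ∀ X → 𝟙 (P? X) ≡ 𝟙 (l ∈? X) * (𝟙 (length X ℕ.≟ k) * 𝟙 (gcdList X ℕ.≟ 1))
    unfold X = trans (𝟙-×-dec (l ∈? X) _) (cong (𝟙 (l ∈? X) *_) (𝟙-×-dec (length X ℕ.≟ k) _))
    count : ∀ {d} → d ∈ divisors l →
      sumℤ (map (λ X → 𝟙 (suc (length X) ℕ.≟ k) * 𝟙 (all? (d ∣?_) X)) (powerset ys)) ≡ + ((m div d ∸ l div d) C j)
    count {d} d∈ = begin
      sumℤ (map (λ X → 𝟙 (suc (length X) ℕ.≟ k) * 𝟙 (all? (d ∣?_) X)) (powerset ys))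
        ≡⟨ sumℤ-cong (powerset ys) (λ {X} _ →
             cong (_* 𝟙 (all? (d ∣?_) X)) (𝟙-suc-≟ (length X) j)) ⟩
      sumℤ (map (λ X → 𝟙 (length X ℕ.≟ j) * 𝟙 (all? (d ∣?_) X)) (powerset ys))
        ≡⟨ sumℤ-powerset-all-length (d ∣?_) ys j ⟩
      + (length (filter (d ∣?_) ys) C j)
        ≡⟨ cong (λ e → + (e C j)) (length-divisor-multiples-between d∈ l≤m) ⟩
      + ((m div d ∸ l div d) C j)         ∎

lemma2 : (l₁ m₁ k : ℕ) → 1 ≤ l₁ → l₁ ≤ m₁ → 1 ≤ k →
    ((+ h1 l₁ m₁) ≡ sumℤ (map (λ d → μ d * (+ (2 ^ (m₁ div d ∸ l₁ div d)))) (divisors l₁)))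
    × ((+ h1k k l₁ m₁) ≡ sumℤ (map (λ d → μ d * (+ ((m₁ div d ∸ l₁ div d) C (k ∸ 1)))) (divisors l₁)))
lemma2 l₁ m₁ k 1≤l₁ l₁≤m₁ 1≤k = h1-formula l₁≤m₁ , h1k-formula l₁≤m₁ k 1≤k
  where instance
  l₁≢0 : NonZero l₁
  l₁≢0 = ℕ.>-nonZero 1≤l₁
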